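{- Let $\mathcal{B}$ be a building set on a finite set $S$, let $i\in S$, and let $\mathcal{B}_1,\dots,\mathcal{B}_k$ be the connected components of $\mathcal{B}|_{S\setminus\{i\}}$. Then the link of the vertex $x_i$ in the extended nested complex satisfies $$\mathrm{Lk}_{\mathcal{N}^{\square}(\mathcal{B})}(x_i)\simeq\mathcal{N}^{\square}(\mathcal{B}_1)*\cdots*\mathcal{N}^{\square}(\mathcal{B}_k).$$
   Context: A building set on a finite set $X$ is a collection $\mathcal{B}$ of nonempty subsets of $X$ containing all singletons and such that $I\cup J\in\mathcal{B}$ whenever $I,J\in\mathcal{B}$, $I\cap J\neq\varnothing$. For $Y\subseteq X$, $\mathcal{B}|_Y=\{J\in\mathcal{B}:J\subseteq Y\}$ is a building set on $Y$; its connected components are the building sets $\mathcal{B}|_M$ for $M$ an inclusion-maximal element of $\mathcal{B}|_Y$. An extended nested collection of $\mathcal{B}$ is a set $\{I_1,\dots,I_m,x_{i_1},\dots,x_{i_r}\}$ with $I_j\in\mathcal{B}$ (maximal elements allowed) and formal symbols $x_i$ ($i\in X$) such that the $I_j$ are pairwise nested or disjoint, no union of $k\ge2$ pairwise disjoint $I_j$'s lies in $\mathcal{B}$, and no $i_\ell$ lies in any $I_j$; $\mathcal{N}^{\square}(\mathcal{B})$ is the simplicial complex on vertex set $\mathcal{B}\cup\{x_i:i\in X\}$ whose faces are the extended nested collections. The link of a vertex $v$ in a complex $\Delta$ is $\{F\in\Delta: v\notin F,\ F\cup\{v\}\in\Delta\}$. The join $\Delta*\Delta'$ has vertex set the disjoint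 union of the vertex sets and faces $F\sqcup F'$ with $F\in\Delta$, $F'\in\Delta'$. $\simeq$ denotes isomorphism of simplicial complexes. -}

module Defs where

open import Data.Nat using (ℕ; _≥_)
open import Data.Bool using (Bool; T; _∧_)
open import Data.Fin using (Fin)
open import Data.Fin.Subset using (Subset; _∈_; _∉_; _⊆_; _∩_; _∪_; ⋃; Nonempty; Empty; ⁅_⁆; ⊤; _-_)
open import Data.Fin.Subset.Properties using (_⊆?_)
open import Data.List using (List; []; _∷_; map; length; partitionSums)
open import Data.List.Membership.Propositional renaming (_∈_ to _∈ˡ_; _∉_ to _∉ˡ_)
open import Data.List.Relation.Unary.Unique.Propositional using (Unique)
open import Data.List.Relation.Unary.AllPairs using (AllPairs)
open import Data.Product using (_×_; proj₁; proj₂; Σ)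
open import Data.Sum using (_⊎_; inj₁; inj₂)
open import Data.Unit using (tt) renaming (⊤ to Unit)
open import Relation.Nullary using (¬_)
open import Relation.Nullary.Decidable using (⌊_⌋)
open import Relation.Binary.PropositionalEquality using (_≡_)
open import Function.Bundles using (_⇔_)

-- Building sets.  The ambient finite set is Fin n; a building set on a
-- ground set Y ⊆ Fin n is a decidable family 𝓑 of subsets of Fin n.

IsBuildingSet : {n : ℕ} → Subset n → (Subset n → Bool) → Set
IsBuildingSet {n} Y 𝓑 =
    (∀ (I : Subset n) → T (𝓑 I) → (I ⊆ Y) × Nonempty I)
  × (∀ (j : Fin n) → j ∈ Y → T (𝓑 ⁅ j ⁆))
  × (∀ (I J : Subset n) → T (𝓑 I) → T (𝓑 J) → Nonempty (I ∩ J) → T (𝓑 (I ∪ J)))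

restrict : {n : ℕ} → (Subset n → Bool) → Subset n → (Subset n → Bool)
restrict 𝓑 Y I = 𝓑 I ∧ ⌊ I ⊆? Y ⌋

IsMaximal : {n : ℕ} → (Subset n → Bool) → Subset n → Set
IsMaximal {n} 𝓑 M = T (𝓑 M) × (∀ (J : Subset n) → T (𝓑 J) → M ⊆ J → J ≡ M)

-- The actual
-- vertices are the v with Face (v ∷ []); other elements of V are unused.

record Complex : Set₁ where
  field
    V    : Set
    Face : List V → Set
open Complex public

Link : (Δ : Complex) → V Δ → Complex
Link Δ v = record { V = V Δ ; Face = λ F → (v ∉ˡ F) × Face Δ (v ∷ F) }

_*_ : Complex → Complex → Complex
Δ * Δ' = record { V = V Δ ⊎ V Δ'
                ; Face = λ F → Face Δ (proj₁ (partitionSums F)) × Face Δ' (proj₂ (partitionSums F)) }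

-- the complex {∅} (unit of the join; its single element tt is not a vertex)
unitComplex : Complex
unitComplex = record { V = Unit ; Face = λ F → F ≡ [] }

JoinAll : List Complex → Complex
JoinAll []       = unitComplex
JoinAll (Δ ∷ Δs) = Δ * JoinAll Δs

record _≃_ (Δ Δ' : Complex) : Set where
  field
    to       : V Δ → V Δ'
    from     : V Δ' → V Δ
    to-face  : ∀ F → Face Δ F → Face Δ' (map to F)
    from-face : ∀ F → Face Δ' F → Face Δ (map from F)
    from-to  : ∀ v → Face Δ (v ∷ []) → from (to v) ≡ v
    to-from  : ∀ w → Face Δ' (w ∷ []) → to (from w) ≡ w

-- Extended nested complex of a building set 𝓑 on ground set Y.
-- Vertices: inj₁ I for I ∈ 𝓑, inj₂ j standing for the symbol x_j, j ∈ Y.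

Disjoint : {n : ℕ} → Subset n → Subset n → Set
Disjoint I J = Empty (I ∩ J)

IsExtNested : {n : ℕ} → Subset n → (Subset n → Bool) → List (Subset n ⊎ Fin n) → Set
IsExtNested {n} Y 𝓑 F =
    (∀ I → I ∈ˡ Is → T (𝓑 I))
  × (∀ j → j ∈ˡ xs → j ∈ Y)
  × (∀ I J → I ∈ˡ Is → J ∈ˡ Is → (I ⊆ J) ⊎ (J ⊆ I) ⊎ Disjoint I J)
  × (∀ (D : List (Subset n)) → (∀ I → I ∈ˡ D → I ∈ˡ Is) → Unique D → length D ≥ 2
       → AllPairs Disjoint D → ¬ T (𝓑 (⋃ D)))
  × (∀ j I → j ∈ˡ xs → I ∈ˡ Is → j ∉ I)
  where
    Is = proj₁ (partitionSums F)
    xs = proj₂ (partitionSums F)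

ExtNestedComplex : {n : ℕ} → Subset n → (Subset n → Bool) → Complex
ExtNestedComplex {n} Y 𝓑 = record { V = Subset n ⊎ Fin n ; Face = IsExtNested Y 𝓑 }

componentComplex : {n : ℕ} → (Subset n → Bool) → Subset n → Complex
componentComplex 𝓑 M = ExtNestedComplex M (restrict 𝓑 M)

-- Every vertex of the link of x_i (a set I ∈ 𝓑 with i ∉ I, or a symbol x_j with j ≠ i) has its
-- support I, resp. {j}, inside a maximal element of 𝓑|_{S∖i}, and inside only one, since two
-- maximal elements of a union-closed family that meet coincide.  Sending a vertex to its copy in
-- the join factor of that component is the isomorphism.  Faces correspond because the nested-set
-- conditions only relate vertices of one component: sets from different components are disjoint,
-- and a union of disjoint sets lying in 𝓑 lies in the component of any of its members.
module Submission where

open import Defs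
open import Data.Nat using (ℕ)
open import Data.Bool using (Bool)
open import Data.Fin using (Fin)
open import Data.Fin.Subset using (Subset; ⊤; _-_)
open import Data.List using (List; map)
open import Data.List.Membership.Propositional using (_∈_; _∉_)
open import Data.List.Relation.Unary.Unique.Propositional using (Unique)
open import Data.Sum using (inj₂)
open import Function.Bundles using (_⇔_)

open import Data.Nat using (_<_; _≥_; _∸_)
open import Data.Nat.Properties using (∸-monoʳ-<)
open import Data.Nat.Induction using (<-wellFounded)
open import Induction.WellFounded using (Acc; acc)
open import Data.Bool using (T)
open import Data.Bool.Properties using (T-∧)
open import Data.Fin.Subset
  using (_─_; ⁅_⁆; ⋃; Nonempty; _⊆_; _∩_; _∪_; ∣_∣; outside; inside)
  renaming (_∈_ to _∈ₛ_; _∉_ to _∉ₛ_)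
open import Data.Fin.Subset.Properties
  using (_⊆?_; _⊂?_; _∈?_; anySubset?; nonempty?; ∣p∣≤n; p⊂q⇒∣p∣<∣q∣; p⊂q⇒p⊆q;
         ⊆-refl; ⊆-trans; ⊆-antisym; x∈⁅x⁆; x∈⁅y⁆⇒x≡y; ∉⊥; x∈p∧x≢y⇒x∈p-y; ∈⊤;
         p⊆p∪q; q⊆p∪q; x∈p∪q⁻; x∈p∩q⁺; x∈p∩q⁻)
open import Data.List using ([]; _∷_; length; partitionSums)
open import Data.List.Relation.Unary.Any using (here; there)
open import Data.Vec.Base using (_∷_; here; there)
open import Data.List.Relation.Unary.All using (lookup)
open import Data.List.Relation.Unary.AllPairs using (AllPairs; _∷_)
open import Data.List.Membership.Propositional.Properties using (∈-map⁻)
open import Data.List.Membership.Propositional.Properties.WithK using (unique⇒irrelevant)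
open import Data.Product using (Σ; ∃; _×_; _,_; proj₁; proj₂)
open import Data.Sum using (_⊎_; inj₁; map₁)
open import Data.Sum.Properties using (inj₂-injective)
open import Data.Unit using (tt)
open import Data.Empty using (⊥-elim)
open import Function.Base using (_∘_; case_of_)
open import Function.Bundles using (Equivalence)
open import Relation.Nullary using (¬_; yes; no; contradiction)
open import Relation.Nullary.Decidable using (toWitness; fromWitness; _×-dec_; T?)
open import Relation.Binary.PropositionalEquality using (_≡_; _≢_; refl; sym; trans; cong; subst)

private
  variable
    n : ℕ

module _ {A B : Set} where

  ∈-partitionSums₁⁻ : ∀ (F : List (A ⊎ B)) {x} → x ∈ proj₁ (partitionSums F) → inj₁ x ∈ F
  ∈-partitionSums₁⁻ (inj₁ y ∷ F) (here refl) = here refl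
  ∈-partitionSums₁⁻ (inj₁ y ∷ F) (there m)   = there (∈-partitionSums₁⁻ F m)
  ∈-partitionSums₁⁻ (inj₂ y ∷ F) m           = there (∈-partitionSums₁⁻ F m)

  ∈-partitionSums₁⁺ : ∀ (F : List (A ⊎ B)) {x} → inj₁ x ∈ F → x ∈ proj₁ (partitionSums F)
  ∈-partitionSums₁⁺ (inj₁ y ∷ F) (here refl) = here refl
  ∈-partitionSums₁⁺ (inj₁ y ∷ F) (there m)   = there (∈-partitionSums₁⁺ F m)
  ∈-partitionSums₁⁺ (inj₂ y ∷ F) (there m)   = ∈-partitionSums₁⁺ F m

  ∈-partitionSums₂⁻ : ∀ (F : List (A ⊎ B)) {x} → x ∈ proj₂ (partitionSums F) → inj₂ x ∈ F
  ∈-partitionSums₂⁻ (inj₂ y ∷ F) (here refl) = here refl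
  ∈-partitionSums₂⁻ (inj₂ y ∷ F) (there m)   = there (∈-partitionSums₂⁻ F m)
  ∈-partitionSums₂⁻ (inj₁ y ∷ F) m           = there (∈-partitionSums₂⁻ F m)

  ∈-partitionSums₂⁺ : ∀ (F : List (A ⊎ B)) {x} → inj₂ x ∈ F → x ∈ proj₂ (partitionSums F)
  ∈-partitionSums₂⁺ (inj₂ y ∷ F) (here refl) = here refl
  ∈-partitionSums₂⁺ (inj₂ y ∷ F) (there m)   = there (∈-partitionSums₂⁺ F m)
  ∈-partitionSums₂⁺ (inj₁ y ∷ F) (there m)   = ∈-partitionSums₂⁺ F m

x∈p─q⇒x∉q : ∀ (p q : Subset n) {x} → x ∈ₛ p ─ q → x ∉ₛ q
x∈p─q⇒x∉q (s ∷ p)       (outside ∷ q) (there x∈) (there x∈q) = x∈p─q⇒x∉q p q x∈ x∈q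
x∈p─q⇒x∉q (s ∷ p)       (inside ∷ q)  (there x∈) (there x∈q) = x∈p─q⇒x∉q p q x∈ x∈q

x∈p-y⇒x≢y : ∀ (p : Subset n) {x y} → x ∈ₛ p - y → x ≢ y
x∈p-y⇒x≢y p {y = y} x∈ refl = x∈p─q⇒x∉q p ⁅ y ⁆ x∈ (x∈⁅x⁆ y)

⁅x⁆⊆p : ∀ {p : Subset n} {x} → x ∈ₛ p → ⁅ x ⁆ ⊆ p
⁅x⁆⊆p {p = p} {x} x∈p y∈⁅x⁆ = subst (_∈ₛ p) (sym (x∈⁅y⁆⇒x≡y x y∈⁅x⁆)) x∈p

⊆-⋃ : ∀ {I : Subset n} {D} → I ∈ D → I ⊆ ⋃ D
⊆-⋃ {D = J ∷ D} (here refl) = p⊆p∪q (⋃ D)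
⊆-⋃ {D = J ∷ D} (there m)   = q⊆p∪q J (⋃ D) ∘ ⊆-⋃ m

⋃-least : ∀ (D : List (Subset n)) {Z} → (∀ {I} → I ∈ D → I ⊆ Z) → ⋃ D ⊆ Z
⋃-least []      h x∈ = contradiction x∈ ∉⊥
⋃-least (J ∷ D) h x∈ with x∈p∪q⁻ J (⋃ D) x∈
... | inj₁ x∈J = h (here refl) x∈J
... | inj₂ x∈⋃ = ⋃-least D (h ∘ there) x∈⋃

T-restrict⁺ : ∀ (𝓒 : Subset n → Bool) {Z I} → T (𝓒 I) → I ⊆ Z → T (restrict 𝓒 Z I)
T-restrict⁺ 𝓒 {Z} {I} t I⊆Z = Equivalence.from T-∧ (t , fromWitness {a? = I ⊆? Z} I⊆Z)

T-restrict⁻ : ∀ (𝓒 : Subset n → Bool) {Z I} → T (restrict 𝓒 Z I) → T (𝓒 I) × I ⊆ Z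
T-restrict⁻ 𝓒 {Z} {I} t with Equivalence.to (T-∧ {𝓒 I}) t
... | (tI , I⊆?Z) = tI , toWitness {a? = I ⊆? Z} I⊆?Z

UnionClosed : (Subset n → Bool) → Set
UnionClosed 𝓒 = ∀ I J → T (𝓒 I) → T (𝓒 J) → Nonempty (I ∩ J) → T (𝓒 (I ∪ J))

restrict-unionClosed : ∀ (𝓒 : Subset n → Bool) Z → UnionClosed 𝓒 → UnionClosed (restrict 𝓒 Z)
restrict-unionClosed 𝓒 Z closed I J tI tJ meet with T-restrict⁻ 𝓒 tI | T-restrict⁻ 𝓒 tJ
... | (tI′ , I⊆Z) | (tJ′ , J⊆Z) = T-restrict⁺ 𝓒 (closed I J tI′ tJ′ meet) I∪J⊆Z
  where
  I∪J⊆Z : I ∪ J ⊆ Z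
  I∪J⊆Z x∈ with x∈p∪q⁻ I J x∈
  ... | inj₁ x∈I = I⊆Z x∈I
  ... | inj₂ x∈J = J⊆Z x∈J

maximal-absorbs : ∀ {𝓒 : Subset n → Bool} {M J} → UnionClosed 𝓒 → IsMaximal 𝓒 M
                → T (𝓒 J) → Nonempty (J ∩ M) → J ⊆ M
maximal-absorbs {M = M} {J} closed (tM , maximal) tJ meet {x} x∈J =
  subst (x ∈ₛ_) (maximal (J ∪ M) (closed J M tJ tM meet) (q⊆p∪q J M)) (p⊆p∪q M x∈J)

maximal-meet⇒≡ : ∀ {𝓒 : Subset n → Bool} {M M′} → UnionClosed 𝓒
               → IsMaximal 𝓒 M → IsMaximal 𝓒 M′ → Nonempty (M ∩ M′) → M ≡ M′
maximal-meet⇒≡ {M = M} {M′} closed mx mx′ (x , x∈M∩M′) with x∈p∩q⁻ M M′ x∈M∩M′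
... | (x∈M , x∈M′) =
  ⊆-antisym (maximal-absorbs closed mx′ (proj₁ mx) (x , x∈p∩q⁺ (x∈M , x∈M′)))
            (maximal-absorbs closed mx (proj₁ mx′) (x , x∈p∩q⁺ (x∈M′ , x∈M)))

⊆-maximal : ∀ (𝓒 : Subset n → Bool) {J} → T (𝓒 J) → ∃ λ M → IsMaximal 𝓒 M × J ⊆ M
⊆-maximal {n} 𝓒 {J} = grow J (<-wellFounded (n ∸ ∣ J ∣))
  where
  grow : ∀ J → Acc _<_ (n ∸ ∣ J ∣) → T (𝓒 J) → ∃ λ M → IsMaximal 𝓒 M × J ⊆ M
  grow J (acc rec) tJ with anySubset? (λ K → T? (𝓒 K) ×-dec (J ⊂? K))
  ... | yes (K , tK , J⊂K) with grow K (rec (∸-monoʳ-< (p⊂q⇒∣p∣<∣q∣ J⊂K) (∣p∣≤n K))) tK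
  ...   | (M , mx , K⊆M) = M , mx , ⊆-trans (p⊂q⇒p⊆q J⊂K) K⊆M
  grow J (acc rec) tJ | no nothing-above = J , (tJ , equal) , ⊆-refl
    where
    equal : ∀ K → T (𝓒 K) → J ⊆ K → K ≡ J
    equal K tK J⊆K = ⊆-antisym K⊆J J⊆K
      where
      K⊆J : K ⊆ J
      K⊆J {x} x∈K with x ∈? J
      ... | yes x∈J = x∈J
      ... | no x∉J  = ⊥-elim (nothing-above (K , tK , J⊆K , x , x∈K , x∉J))

Vertex : ℕ → Set
Vertex n = Subset n ⊎ Fin n

support : Vertex n → Subset n
support (inj₁ I) = I
support (inj₂ j) = ⁅ j ⁆

-- IsExtNested depends only on which vertices a face contains; ExtNested is the same
-- condition for a predicate on vertices, so faces can be compared up to membership.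
record ExtNested (Y : Subset n) (𝓒 : Subset n → Bool) (P : Vertex n → Set) : Set where
  field
    sets∈       : ∀ I → P (inj₁ I) → T (𝓒 I)
    symbols∈    : ∀ j → P (inj₂ j) → j ∈ₛ Y
    nested      : ∀ I J → P (inj₁ I) → P (inj₁ J) → (I ⊆ J) ⊎ (J ⊆ I) ⊎ Disjoint I J
    unions∉     : ∀ D → (∀ I → I ∈ D → P (inj₁ I)) → Unique D → length D ≥ 2
                → AllPairs Disjoint D → ¬ T (𝓒 (⋃ D))
    symbols∉sets : ∀ j I → P (inj₂ j) → P (inj₁ I) → j ∉ₛ I
open ExtNested

ExtNested-mono : ∀ {Y 𝓒} {P Q : Vertex n → Set} → (∀ {v} → Q v → P v)
               → ExtNested Y 𝓒 P → ExtNested Y 𝓒 Q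
ExtNested-mono Q⊆P G = record
  { sets∈        = λ I q → sets∈ G I (Q⊆P q)
  ; symbols∈     = λ j q → symbols∈ G j (Q⊆P q)
  ; nested       = λ I J q q′ → nested G I J (Q⊆P q) (Q⊆P q′)
  ; unions∉      = λ D all → unions∉ G D (λ I m → Q⊆P (all I m))
  ; symbols∉sets = λ j I q q′ → symbols∉sets G j I (Q⊆P q) (Q⊆P q′)
  }

isExtNested⇒ExtNested : ∀ {Y 𝓒} (F : List (Vertex n)) → IsExtNested Y 𝓒 F → ExtNested Y 𝓒 (_∈ F)
isExtNested⇒ExtNested F (sets , symbols , nest , unions , apart) = record
  { sets∈        = λ I m → sets I (∈-partitionSums₁⁺ F m)
  ; symbols∈     = λ j m → symbols j (∈-partitionSums₂⁺ F m)
  ; nested       = λ I J m m′ → nest I J (∈-partitionSums₁⁺ F m) (∈-partitionSums₁⁺ F m′)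
  ; unions∉      = λ D all → unions D (λ I m → ∈-partitionSums₁⁺ F (all I m))
  ; symbols∉sets = λ j I m m′ → apart j I (∈-partitionSums₂⁺ F m) (∈-partitionSums₁⁺ F m′)
  }

ExtNested⇒isExtNested : ∀ {Y 𝓒} (F : List (Vertex n)) → ExtNested Y 𝓒 (_∈ F) → IsExtNested Y 𝓒 F
ExtNested⇒isExtNested F G =
    (λ I m → sets∈ G I (∈-partitionSums₁⁻ F m))
  , (λ j m → symbols∈ G j (∈-partitionSums₂⁻ F m))
  , (λ I J m m′ → nested G I J (∈-partitionSums₁⁻ F m) (∈-partitionSums₁⁻ F m′))
  , (λ D all → unions∉ G D (λ I m → ∈-partitionSums₁⁻ F (all I m)))
  , (λ j I m m′ → symbols∉sets G j I (∈-partitionSums₂⁻ F m) (∈-partitionSums₁⁻ F m′))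

ExtNested-restrict : ∀ {Y 𝓒} {P : Vertex n → Set} M → ExtNested Y 𝓒 P
                   → ExtNested M (restrict 𝓒 M) (λ v → P v × support v ⊆ M)
ExtNested-restrict {𝓒 = 𝓒} M G = record
  { sets∈        = λ I (p , I⊆M) → T-restrict⁺ 𝓒 (sets∈ G I p) I⊆M
  ; symbols∈     = λ j (_ , j⊆M) → j⊆M (x∈⁅x⁆ j)
  ; nested       = λ I J p p′ → nested G I J (proj₁ p) (proj₁ p′)
  ; unions∉      = λ D all u len apart t →
                     unions∉ G D (λ I → proj₁ ∘ all I) u len apart (proj₁ (T-restrict⁻ 𝓒 t))
  ; symbols∉sets = λ j I p p′ → symbols∉sets G j I (proj₁ p) (proj₁ p′)
  }

module Join {n} (𝓑 : Subset n → Bool) where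

  VJ : List (Subset n) → Set
  VJ Ms = V (JoinAll (map (componentComplex 𝓑) Ms))

  inject : ∀ {M Ms} → M ∈ Ms → Vertex n → VJ Ms
  inject (here _)  v = inj₁ v
  inject (there p) v = inj₂ (inject p v)

  InFactor : ∀ Ms → VJ Ms → Set
  InFactor Ms w = ∃ λ M → Σ (M ∈ Ms) λ p → ∃ λ v → w ≡ inject p v

  JoinNested : ∀ Ms → (VJ Ms → Set) → Set
  JoinNested []       Q = ∀ w → ¬ Q w
  JoinNested (M ∷ Ms) Q = ExtNested M (restrict 𝓑 M) (Q ∘ inj₁) × JoinNested Ms (Q ∘ inj₂)

  JoinNested-mono : ∀ Ms {P Q : VJ Ms → Set} → (∀ {w} → Q w → P w) → JoinNested Ms P → JoinNested Ms Q
  JoinNested-mono []       Q⊆P J         = λ w → J w ∘ Q⊆P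
  JoinNested-mono (M ∷ Ms) Q⊆P (G , J) = ExtNested-mono Q⊆P G , JoinNested-mono Ms Q⊆P J

  face⇒JoinNested : ∀ Ms L → Face (JoinAll (map (componentComplex 𝓑) Ms)) L → JoinNested Ms (_∈ L)
  face⇒JoinNested []       L refl       = λ w ()
  face⇒JoinNested (M ∷ Ms) L (f₁ , f₂) =
      ExtNested-mono (∈-partitionSums₁⁺ L) (isExtNested⇒ExtNested _ f₁)
    , JoinNested-mono Ms (∈-partitionSums₂⁺ L) (face⇒JoinNested Ms _ f₂)

  JoinNested⇒face : ∀ Ms L → JoinNested Ms (_∈ L) → Face (JoinAll (map (componentComplex 𝓑) Ms)) L
  JoinNested⇒face []       []      J       = refl
  JoinNested⇒face []       (w ∷ L) J       = contradiction (here refl) (J w)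
  JoinNested⇒face (M ∷ Ms) L       (G , J) =
      ExtNested⇒isExtNested _ (ExtNested-mono (∈-partitionSums₁⁻ L) G)
    , JoinNested⇒face Ms _ (JoinNested-mono Ms (∈-partitionSums₂⁻ L) J)

  JoinNested-component : ∀ {Ms Q M} → JoinNested Ms Q → (p : M ∈ Ms)
                       → ExtNested M (restrict 𝓑 M) (Q ∘ inject p)
  JoinNested-component (G , _) (here refl) = G
  JoinNested-component (_ , J) (there p)   = JoinNested-component J p

  JoinNested-inFactor : ∀ {Ms Q w} → JoinNested Ms Q → Q w → InFactor Ms w
  JoinNested-inFactor {[]}     {w = w}     J       q = contradiction q (J w)
  JoinNested-inFactor {M ∷ Ms} {w = inj₁ v} _       _ = M , here refl , v , refl
  JoinNested-inFactor {M ∷ Ms} {w = inj₂ w} (_ , J) q with JoinNested-inFactor J q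
  ... | (M′ , p , v , refl) = M′ , there p , v , refl

  JoinNested-intro : ∀ Ms {Q} → (∀ {M} (p : M ∈ Ms) → ExtNested M (restrict 𝓑 M) (Q ∘ inject p))
                   → (∀ {w} → Q w → InFactor Ms w) → JoinNested Ms Q
  JoinNested-intro []       _         inFactor = λ w q → case inFactor q of λ { (_ , () , _) }
  JoinNested-intro (M ∷ Ms) {Q} component inFactor =
    component (here refl) , JoinNested-intro Ms (component ∘ there) inFactor′
    where
    inFactor′ : ∀ {w} → Q (inj₂ w) → InFactor Ms w
    inFactor′ q with inFactor q
    ... | (M′ , there p , v , refl) = M′ , p , v , refl

  Separated : List (Subset n) → Set
  Separated Ms = ∀ {M M′} → M ∈ Ms → M′ ∈ Ms → Nonempty (M ∩ M′) → M ≡ M′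

  place : ∀ Ms → Vertex n → VJ Ms
  place []       v = tt
  place (M ∷ Ms) v with support v ⊆? M
  ... | yes _ = inj₁ v
  ... | no _  = inj₂ (place Ms v)

  place≡inject⇒ : ∀ Ms {M u v} (p : M ∈ Ms) → place Ms v ≡ inject p u → u ≡ v × support v ⊆ M
  place≡inject⇒ (M ∷ Ms) {v = v} p e with support v ⊆? M
  place≡inject⇒ (M ∷ Ms) (here refl) refl | yes v⊆M = refl , v⊆M
  place≡inject⇒ (M ∷ Ms) (there p)   ()   | yes _
  place≡inject⇒ (M ∷ Ms) (here refl) ()   | no _
  place≡inject⇒ (M ∷ Ms) (there p)   e    | no _    = place≡inject⇒ Ms p (inj₂-injective e)

  place-inject : ∀ {Ms M v} → Unique Ms → Separated Ms → (p : M ∈ Ms)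
               → Nonempty (support v) → support v ⊆ M → place Ms v ≡ inject p v
  place-inject {M′ ∷ Ms} {v = v} u sep p ne v⊆M with support v ⊆? M′
  place-inject _        sep (here refl) ne v⊆M | yes _    = refl
  place-inject (u ∷ _)  sep (there p)   (x , x∈v) v⊆M | yes v⊆M′ =
    contradiction (sep (here refl) (there p) (x , x∈p∩q⁺ (v⊆M′ x∈v , v⊆M x∈v))) (lookup u p)
  place-inject _        sep (here refl) ne v⊆M | no v⊈M = ⊥-elim (v⊈M v⊆M)
  place-inject (_ ∷ us) sep (there p)   ne v⊆M | no _  =
    cong inj₂ (place-inject us (λ q q′ → sep (there q) (there q′)) p ne v⊆M)

  inject-meet : ∀ {Ms M M′} → Unique Ms → Separated Ms → (p : M ∈ Ms) (p′ : M′ ∈ Ms)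
              → Nonempty (M ∩ M′) → ∀ v → inject p v ≡ inject p′ v
  inject-meet u sep p p′ meet v with sep p p′ meet
  ... | refl = cong (λ q → inject q v) (unique⇒irrelevant u p p′)

module LinkOfSymbol {n} (𝓑 : Subset n → Bool) (bs : IsBuildingSet ⊤ 𝓑) (i : Fin n)
  (Ms : List (Subset n)) (uniq : Unique Ms)
  (Ms⇔maximal : ∀ M → (M ∈ Ms) ⇔ IsMaximal (restrict 𝓑 (⊤ - i)) M) where

  open Join 𝓑

  nonempty : ∀ {I} → T (𝓑 I) → Nonempty I
  nonempty {I} t = proj₂ (proj₁ bs I t)

  singleton : ∀ j → T (𝓑 ⁅ j ⁆)
  singleton j = proj₁ (proj₂ bs) j ∈⊤

  maximal : ∀ {M} → M ∈ Ms → IsMaximal (restrict 𝓑 (⊤ - i)) M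
  maximal {M} = Equivalence.to (Ms⇔maximal M)

  component⊆ : ∀ {M} → M ∈ Ms → M ⊆ ⊤ - i
  component⊆ p = proj₂ (T-restrict⁻ 𝓑 (proj₁ (maximal p)))

  i∉component : ∀ {M} → M ∈ Ms → i ∉ₛ M
  i∉component p i∈M = x∈p-y⇒x≢y ⊤ (component⊆ p i∈M) refl

  unionClosed : UnionClosed (restrict 𝓑 (⊤ - i))
  unionClosed = restrict-unionClosed 𝓑 (⊤ - i) (proj₂ (proj₂ bs))

  separated : Separated Ms
  separated p p′ = maximal-meet⇒≡ unionClosed (maximal p) (maximal p′)

  covered : ∀ {S} → T (𝓑 S) → i ∉ₛ S → ∃ λ M → M ∈ Ms × S ⊆ M
  covered {S} t i∉S with ⊆-maximal (restrict 𝓑 (⊤ - i)) (T-restrict⁺ 𝓑 t S⊆)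
    where
    S⊆ : S ⊆ ⊤ - i
    S⊆ x∈S = x∈p∧x≢y⇒x∈p-y ∈⊤ λ { refl → i∉S x∈S }
  ... | (M , mx , S⊆M) = M , Equivalence.from (Ms⇔maximal M) mx , S⊆M

  component-vertex : ∀ {M P v} → ExtNested M (restrict 𝓑 M) P → P v
                   → T (𝓑 (support v)) × support v ⊆ M
  component-vertex {v = inj₁ I} G p = T-restrict⁻ 𝓑 (sets∈ G I p)
  component-vertex {v = inj₂ j} G p = singleton j , ⁅x⁆⊆p (symbols∈ G j p)

  link-vertex : ∀ {F v} → ExtNested ⊤ 𝓑 (_∈ (inj₂ i ∷ F)) → inj₂ i ∉ F → v ∈ F
              → T (𝓑 (support v)) × i ∉ₛ support v
  link-vertex {v = inj₁ I} G _   m = sets∈ G I (there m) , symbols∉sets G i I (here refl) (there m)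
  link-vertex {F} {inj₂ j} G i∉F m =
    singleton j , λ i∈⁅j⁆ → i∉F (subst (λ k → inj₂ k ∈ F) (sym (x∈⁅y⁆⇒x≡y j i∈⁅j⁆)) m)

  placed : ∀ {M v} (p : M ∈ Ms) → T (𝓑 (support v)) → support v ⊆ M → place Ms v ≡ inject p v
  placed p t = place-inject uniq separated p (nonempty t)

  place-link : ∀ {F v} → ExtNested ⊤ 𝓑 (_∈ (inj₂ i ∷ F)) → inj₂ i ∉ F → v ∈ F
             → InFactor Ms (place Ms v)
  place-link G i∉F m with link-vertex G i∉F m
  ... | (t , i∉v) with covered t i∉v
  ...   | (M , p , v⊆M) = M , p , _ , placed p t v⊆M

  -- The value on the unit vertex tt at the end of the join is junk: tt lies in no face.
  project : ∀ Ns → VJ Ns → Vertex n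
  project []       _        = inj₂ i
  project (_ ∷ Ns) (inj₁ v) = v
  project (_ ∷ Ns) (inj₂ w) = project Ns w

  project-inject : ∀ {Ns M} (p : M ∈ Ns) v → project Ns (inject p v) ≡ v
  project-inject (here _)  v = refl
  project-inject (there p) v = project-inject p v

  project-place : ∀ {v} → InFactor Ms (place Ms v) → project Ms (place Ms v) ≡ v
  project-place (_ , p , u , e) with place≡inject⇒ Ms p e
  ... | (refl , _) = trans (cong (project Ms) e) (project-inject p u)

  place-project : ∀ {w} → JoinNested Ms (_∈ (w ∷ [])) → place Ms (project Ms w) ≡ w
  place-project J with JoinNested-inFactor J (here refl)
  ... | (_ , p , v , refl) with component-vertex (JoinNested-component J p) (here refl)
  ...   | (t , v⊆M) = trans (cong (place Ms) (project-inject p v)) (placed p t v⊆M)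

  link⇒joinNested : ∀ F → Face (Link (ExtNestedComplex ⊤ 𝓑) (inj₂ i)) F
                  → JoinNested Ms (_∈ map (place Ms) F)
  link⇒joinNested F (i∉F , ext) = JoinNested-intro Ms component inFactor
    where
    G : ExtNested ⊤ 𝓑 (_∈ (inj₂ i ∷ F))
    G = isExtNested⇒ExtNested _ ext

    component : ∀ {M} (p : M ∈ Ms) → ExtNested M (restrict 𝓑 M) (λ u → inject p u ∈ map (place Ms) F)
    component {M} p = ExtNested-mono from-F (ExtNested-restrict M (ExtNested-mono there G))
      where
      from-F : ∀ {u} → inject p u ∈ map (place Ms) F → u ∈ F × support u ⊆ M
      from-F m with ∈-map⁻ (place Ms) m
      ... | (v , v∈F , e) with place≡inject⇒ Ms p (sym e)
      ...   | (refl , v⊆M) = v∈F , v⊆M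

    inFactor : ∀ {w} → w ∈ map (place Ms) F → InFactor Ms w
    inFactor m with ∈-map⁻ (place Ms) m
    ... | (v , v∈F , refl) = place-link G i∉F v∈F

  Occurs : (VJ Ms → Set) → Vertex n → Set
  Occurs Q v = ∃ λ M → Σ (M ∈ Ms) λ p → Q (inject p v)

  module _ {Q : VJ Ms → Set} (joined : JoinNested Ms Q) where

    occurs-set : ∀ {I} (o : Occurs Q (inj₁ I)) → T (𝓑 I) × I ⊆ proj₁ o
    occurs-set (_ , p , q) = component-vertex (JoinNested-component joined p) q

    occurs⊆ : ∀ {I} → Occurs Q (inj₁ I) → I ⊆ ⊤ - i
    occurs⊆ o@(_ , p , _) = ⊆-trans (proj₂ (occurs-set o)) (component⊆ p)

    move : ∀ {M M′ v} (p : M ∈ Ms) (p′ : M′ ∈ Ms) → Nonempty (M ∩ M′)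
         → Q (inject p v) → Q (inject p′ v)
    move p p′ meet = subst Q (inject-meet uniq separated p p′ meet _)

    project-occurs : ∀ {w} → Q w → Occurs Q (project Ms w)
    project-occurs q with JoinNested-inFactor joined q
    ... | (M , p , v , refl) = M , p , subst (Q ∘ inject p) (sym (project-inject p v)) q

    i∉occurs : ¬ Occurs Q (inj₂ i)
    i∉occurs (_ , p , q) = i∉component p (symbols∈ (JoinNested-component joined p) i q)

    nested-or-disjoint : ∀ I J → Occurs Q (inj₁ I) → Occurs Q (inj₁ J)
                       → (I ⊆ J) ⊎ (J ⊆ I) ⊎ Disjoint I J
    nested-or-disjoint I J o@(_ , p , q) o′@(_ , p′ , q′) with nonempty? (I ∩ J)
    ... | no  I∩J=∅      = inj₂ (inj₂ I∩J=∅)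
    ... | yes (x , x∈I∩J) with x∈p∩q⁻ I J x∈I∩J
    ...   | (x∈I , x∈J) =
      nested (JoinNested-component joined p) I J q
        (move p′ p (x , x∈p∩q⁺ (proj₂ (occurs-set o′) x∈J , proj₂ (occurs-set o) x∈I)) q′)

    symbol∉set : ∀ j I → j ≡ i ⊎ Occurs Q (inj₂ j) → Occurs Q (inj₁ I) → j ∉ₛ I
    symbol∉set j I (inj₁ refl) o j∈I = x∈p-y⇒x≢y ⊤ (occurs⊆ o j∈I) refl
    symbol∉set j I (inj₂ (_ , p , q)) o′@(_ , p′ , q′) j∈I =
      symbols∉sets G j I q (move p′ p (j , x∈p∩q⁺ (proj₂ (occurs-set o′) j∈I , symbols∈ G j q)) q′) j∈I
      where
      G = JoinNested-component joined p

    disjoint-union∉𝓑 : ∀ D → (∀ I → I ∈ D → Occurs Q (inj₁ I)) → Unique D → length D ≥ 2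
                      → AllPairs Disjoint D → ¬ T (𝓑 (⋃ D))
    disjoint-union∉𝓑 (I₁ ∷ D) occ u len apart t with occ I₁ (here refl)
    ... | o₁@(M , p , q) =
      unions∉ (JoinNested-component joined p) (I₁ ∷ D) all-in-M u len apart (T-restrict⁺ 𝓑 t ⋃⊆M)
      where
      meet : Nonempty (⋃ (I₁ ∷ D) ∩ M)
      meet with nonempty (proj₁ (occurs-set o₁))
      ... | (x , x∈I₁) = x , x∈p∩q⁺ (⊆-⋃ {D = I₁ ∷ D} (here refl) x∈I₁ , proj₂ (occurs-set o₁) x∈I₁)

      ⋃⊆M : ⋃ (I₁ ∷ D) ⊆ M
      ⋃⊆M = maximal-absorbs unionClosed (maximal p)
              (T-restrict⁺ 𝓑 t (⋃-least (I₁ ∷ D) (λ m → occurs⊆ (occ _ m)))) meet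

      all-in-M : ∀ I → I ∈ I₁ ∷ D → Q (inject p (inj₁ I))
      all-in-M I m with occ I m
      ... | o@(_ , p′ , q′) with nonempty (proj₁ (occurs-set o))
      ...   | (x , x∈I) = move p′ p (x , x∈p∩q⁺ (proj₂ (occurs-set o) x∈I , ⋃⊆M (⊆-⋃ m x∈I))) q′

    joinNested⇒link : ExtNested ⊤ 𝓑 (λ v → v ≡ inj₂ i ⊎ Occurs Q v)
    joinNested⇒link = record
      { sets∈        = λ I o → proj₁ (occurs-set (set o))
      ; symbols∈     = λ _ _ → ∈⊤
      ; nested       = λ I J o o′ → nested-or-disjoint I J (set o) (set o′)
      ; unions∉      = λ D occ → disjoint-union∉𝓑 D (λ I → set ∘ occ I)
      ; symbols∉sets = λ j I o o′ → symbol∉set j I (map₁ inj₂-injective o) (set o′)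
      }
      where
      set : ∀ {I} → inj₁ I ≡ inj₂ i ⊎ Occurs Q (inj₁ I) → Occurs Q (inj₁ I)
      set (inj₂ o) = o

  join⇒link : ∀ L → Face (JoinAll (map (componentComplex 𝓑) Ms)) L
            → Face (Link (ExtNestedComplex ⊤ 𝓑) (inj₂ i)) (map (project Ms) L)
  join⇒link L f = i∉ , ExtNested⇒isExtNested _ (ExtNested-mono classify (joinNested⇒link J))
    where
    J : JoinNested Ms (_∈ L)
    J = face⇒JoinNested Ms L f

    i∉ : ¬ inj₂ i ∈ map (project Ms) L
    i∉ m with ∈-map⁻ (project Ms) m
    ... | (w , w∈L , e) = i∉occurs J (subst (Occurs (_∈ L)) (sym e) (project-occurs J w∈L))

    classify : ∀ {v} → v ∈ inj₂ i ∷ map (project Ms) L → v ≡ inj₂ i ⊎ Occurs (_∈ L) v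
    classify (here e)  = inj₁ e
    classify (there m) with ∈-map⁻ (project Ms) m
    ... | (w , w∈L , refl) = inj₂ (project-occurs J w∈L)

  link≃join : Link (ExtNestedComplex ⊤ 𝓑) (inj₂ i) ≃ JoinAll (map (componentComplex 𝓑) Ms)
  link≃join = record
    { to        = place Ms
    ; from      = project Ms
    ; to-face   = λ F f → JoinNested⇒face Ms _ (link⇒joinNested F f)
    ; from-face = join⇒link
    ; from-to   = λ v (i∉v , ext) →
                    project-place (place-link (isExtNested⇒ExtNested _ ext) i∉v (here refl))
    ; to-from   = λ w f → place-project (face⇒JoinNested Ms _ f)
    }

proposition2p25 : (n : ℕ) (𝓑 : Subset n → Bool) → IsBuildingSet ⊤ 𝓑 → (i : Fin n)
    → (Ms : List (Subset n)) → Unique Ms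
    → (∀ M → (M ∈ Ms) ⇔ IsMaximal (restrict 𝓑 (⊤ - i)) M)
    → Link (ExtNestedComplex ⊤ 𝓑) (inj₂ i) ≃ JoinAll (map (componentComplex 𝓑) Ms)
proposition2p25 n 𝓑 bs i Ms uniq Ms⇔maximal = LinkOfSymbol.link≃join 𝓑 bs i Ms uniq Ms⇔maximal
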